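{- For $n\ge 4$, $\mathrm{thin}_{cmp}(CR_n)=2n-4$, while $\mathrm{thin}_{cmp}(CR_3)=3$ and $\mathrm{thin}_{cmp}(CR_1)=\mathrm{thin}_{cmp}(CR_2)=2$. The same values hold for the complete proper thinness $\mathrm{pthin}_{cmp}(CR_n)$.
   Context: The crown graph $CR_n$ is obtained from $K_{n,n}$ by removing a perfect matching. An ordering $<$ of $V(G)$ is consistent with a partition $\mathcal{V}$ if for every $p<q<r$ with $p,q$ in the same class and $pr\in E(G)$, also $qr\in E(G)$; strongly consistent if both $<$ and its reversal are consistent. The complete thinness $\mathrm{thin}_{cmp}(G)$ (resp. complete proper thinness $\mathrm{pthin}_{cmp}(G)$) is the minimum $k$ such that $V(G)$ has a partition into $k$ cliques and an ordering consistent (resp. strongly consistent) with it. -}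

module Defs where

open import Data.Nat using (ℕ; _<_; _≤_)
open import Data.Fin using (Fin)
open import Data.Sum using (_⊎_; inj₁; inj₂)
open import Data.Product using (Σ; _×_; ∃)
open import Data.Empty using (⊥)
open import Relation.Nullary using (¬_)
open import Relation.Binary.PropositionalEquality using (_≡_; _≢_)
open import Function.Definitions using (Injective; Surjective)

record Graph : Set₁ where
  field
    V : Set
    E : V → V → Set

open Graph public

-- Crown graph CR_n: K_{n,n} on (Fin n ⊎ Fin n) minus the perfect matching {inj₁ i, inj₂ i}.
CRE : (n : ℕ) → Fin n ⊎ Fin n → Fin n ⊎ Fin n → Set
CRE n (inj₁ i) (inj₁ j) = ⊥
CRE n (inj₁ i) (inj₂ j) = i ≢ j
CRE n (inj₂ i) (inj₁ j) = i ≢ j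
CRE n (inj₂ i) (inj₂ j) = ⊥

CR : ℕ → Graph
CR n = record { V = Fin n ⊎ Fin n ; E = CRE n }

-- A linear ordering of V is given by an injective position map into ℕ:
-- p < q iff pos p < pos q.  A partition into k classes is a surjective map c : V → Fin k.

Consistent : (G : Graph) {k : ℕ} → (V G → ℕ) → (V G → Fin k) → Set
Consistent G pos c = ∀ p q r → pos p < pos q → pos q < pos r →
  c p ≡ c q → E G p r → E G q r

ConsistentRev : (G : Graph) {k : ℕ} → (V G → ℕ) → (V G → Fin k) → Set
ConsistentRev G pos c = ∀ p q r → pos r < pos q → pos q < pos p →
  c p ≡ c q → E G p r → E G q r

CliquePartition : (G : Graph) {k : ℕ} → (V G → Fin k) → Set
CliquePartition G c = ∀ p q → c p ≡ c q → p ≢ q → E G p q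

HasCompleteThin : Graph → ℕ → Set
HasCompleteThin G k = Σ (V G → ℕ) λ pos → Σ (V G → Fin k) λ c →
  Injective _≡_ _≡_ pos × Surjective _≡_ _≡_ c × CliquePartition G c × Consistent G pos c

HasCompleteProperThin : Graph → ℕ → Set
HasCompleteProperThin G k = Σ (V G → ℕ) λ pos → Σ (V G → Fin k) λ c →
  Injective _≡_ _≡_ pos × Surjective _≡_ _≡_ c × CliquePartition G c ×
  Consistent G pos c × ConsistentRev G pos c

ThinCmpIs : Graph → ℕ → Set
ThinCmpIs G k = HasCompleteThin G k × (∀ k′ → HasCompleteThin G k′ → k ≤ k′)

PThinCmpIs : Graph → ℕ → Set
PThinCmpIs G k = HasCompleteProperThin G k × (∀ k′ → HasCompleteProperThin G k′ → k ≤ k′)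

module Submission where

open import Defs
open import Data.Nat using (ℕ; zero; suc; _+_; _*_; _∸_; _≤_; _<_; z≤n; s≤s; _<?_)
open import Data.Nat.Properties
open import Data.Fin using (Fin; zero; suc; toℕ; punchIn; splitAt; join) renaming (_≟_ to _≟ᶠ_)
import Data.Fin.Properties as Finₚ
open import Data.Sum using (_⊎_; inj₁; inj₂)
open import Data.Sum.Properties using (inj₁-injective; inj₂-injective; ≡-dec)
open import Data.Product using (_×_; _,_; proj₁; proj₂; ∃-syntax)
open import Data.Empty using (⊥-elim)
open import Function using (_∘_)
open import Function.Definitions using (Injective; Surjective)
open import Function.Consequences.Propositional
  using (inverseʳ⇒injective; strictlyInverseʳ⇒inverseʳ; strictlySurjective⇒surjective)
open import Relation.Nullary using (¬_; Dec; yes; no; ¬?)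
open import Relation.Nullary.Decidable using (from-yes; map′; _→-dec_; _×-dec_; _⊎-dec_)
open import Relation.Binary.Definitions using (Symmetric; tri<; tri≈; tri>)
open import Relation.Binary.PropositionalEquality

-- In a consistent clique partition of CR_n every class has at most two vertices, one from
-- each side, and consistency forces every vertex of the later one's side, except the mate of
-- the earlier one, to precede it: it is one of the last two vertices of its side. Hence at
-- most four classes have two vertices, and k ≥ 2n − 4. For n ≥ 4 this is attained
-- by pairing a0b1, a1b0, b2a3, b3a2 along the order a0 a1 b2 b3 | other a's | other b's |
-- a2 a3 b0 b1, every other vertex forming its own class; for n ≤ 3 the value is forced by
-- the independent side (and, for n = 1, by CR_1 having no edges), and attained by small
-- explicit orderings.

Vertex : ℕ → Set
Vertex n = Fin n ⊎ Fin n

proper⇒thin : ∀ {G k} → HasCompleteProperThin G k → HasCompleteThin G k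
proper⇒thin (pos , c , pos-inj , c-surj , clique , consistent , _) =
  pos , c , pos-inj , c-surj , clique , consistent

thinCmpIs×pthinCmpIs : ∀ {G k} → HasCompleteProperThin G k →
  (∀ k′ → HasCompleteThin G k′ → k ≤ k′) → ThinCmpIs G k × PThinCmpIs G k
thinCmpIs×pthinCmpIs P lower = (proper⇒thin P , lower) , (P , λ k′ → lower k′ ∘ proper⇒thin)

independent⇒≤ : ∀ {G k m} (f : Fin m → V G) → Injective _≡_ _≡_ f →
  (∀ i j → ¬ E G (f i) (f j)) → HasCompleteThin G k → m ≤ k
independent⇒≤ f f-inj independent (_ , c , _ , _ , clique , _) = Finₚ.injective⇒≤ c∘f-inj
  where
  c∘f-inj : Injective _≡_ _≡_ (c ∘ f)
  c∘f-inj {i} {j} eq with i ≟ᶠ j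
  ... | yes i≡j = i≡j
  ... | no i≢j = ⊥-elim (independent i j (clique (f i) (f j) eq (i≢j ∘ f-inj)))

ConsistentPair : (G : Graph) → (V G → ℕ) → V G → V G → Set
ConsistentPair G pos p q =
  E G p q × (∀ r → pos q < pos r → E G p r → E G q r) × (∀ r → pos r < pos p → E G q r → E G p r)

consistentPairs⇒properThin : ∀ {G k} (pos : V G → ℕ) (c : V G → Fin k) → Symmetric (E G) →
  Injective _≡_ _≡_ pos → Surjective _≡_ _≡_ c →
  (∀ {p q} → c p ≡ c q → pos p < pos q → ConsistentPair G pos p q) → HasCompleteProperThin G k
consistentPairs⇒properThin {G} pos c E-sym pos-inj c-surj pair =
  pos , c , pos-inj , c-surj , clique , consistent , consistentRev
  where
  clique : CliquePartition G c
  clique p q eq p≢q with <-cmp (pos p) (pos q)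
  ... | tri< p<q _ _ = proj₁ (pair eq p<q)
  ... | tri≈ _ p≡q _ = ⊥-elim (p≢q (pos-inj p≡q))
  ... | tri> _ _ q<p = E-sym (proj₁ (pair (sym eq) q<p))

  consistent : Consistent G pos c
  consistent p q r p<q q<r eq = proj₁ (proj₂ (pair eq p<q)) r q<r

  consistentRev : ConsistentRev G pos c
  consistentRev p q r r<q q<p eq = proj₂ (proj₂ (pair (sym eq) q<p)) r r<q

argmax : ∀ {n} → (Fin (suc n) → ℕ) → Fin (suc n)
argmax {zero} f = zero
argmax {suc n} f with f zero ≤? f (suc (argmax (f ∘ suc)))
... | yes _ = suc (argmax (f ∘ suc))
... | no _ = zero

f≤f[argmax] : ∀ {n} (f : Fin (suc n) → ℕ) i → f i ≤ f (argmax f)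
f≤f[argmax] {zero} f zero = ≤-refl
f≤f[argmax] {suc n} f i with f zero ≤? f (suc (argmax (f ∘ suc)))
f≤f[argmax] {suc n} f zero | yes f₀≤ = f₀≤
f≤f[argmax] {suc n} f (suc i) | yes _ = f≤f[argmax] (f ∘ suc) i
f≤f[argmax] {suc n} f zero | no _ = ≤-refl
f≤f[argmax] {suc n} f (suc i) | no f₀≰ = ≤-trans (f≤f[argmax] (f ∘ suc) i) (<⇒≤ (≰⇒> f₀≰))

module TopTwo {n} (f : Fin (2 + n) → ℕ) where

  top : Fin (2 + n)
  top = argmax f

  second : Fin (suc n)
  second = argmax (f ∘ punchIn top)

  others : Fin n → Fin (2 + n)
  others = punchIn top ∘ punchIn second

  others-injective : Injective _≡_ _≡_ others
  others-injective = Finₚ.punchIn-injective second _ _ ∘ Finₚ.punchIn-injective top _ _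

  others-dominated : ∀ i j → ∃[ l ] l ≢ i × l ≢ others j × f (others j) ≤ f l
  others-dominated i j with top ≟ᶠ i
  ... | no top≢i = top , top≢i , Finₚ.punchInᵢ≢i top _ ∘ sym , f≤f[argmax] f (others j)
  ... | yes refl =
    punchIn top second , Finₚ.punchInᵢ≢i top second ,
    Finₚ.punchInᵢ≢i second j ∘ sym ∘ Finₚ.punchIn-injective top _ _ ,
    f≤f[argmax] (f ∘ punchIn top) (punchIn second j)

CRE-sym : ∀ {n} → Symmetric (CRE n)
CRE-sym {x = inj₁ _} {inj₁ _} ()
CRE-sym {x = inj₁ _} {inj₂ _} i≢j = i≢j ∘ sym
CRE-sym {x = inj₂ _} {inj₁ _} i≢j = i≢j ∘ sym
CRE-sym {x = inj₂ _} {inj₂ _} ()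

module _ {n : ℕ} (pos : Vertex n → ℕ) where

  consistentPair₁₂ : ∀ {i j} → i ≢ j →
    (∀ l → pos (inj₂ j) < pos (inj₂ l) → l ≡ i) → (∀ l → pos (inj₁ l) < pos (inj₁ i) → l ≡ j) →
    ConsistentPair (CR n) pos (inj₁ i) (inj₂ j)
  consistentPair₁₂ {i} {j} i≢j onlyMateAfter onlyMateBefore = i≢j , later , earlier
    where
    later : ∀ r → pos (inj₂ j) < pos r → CRE n (inj₁ i) r → CRE n (inj₂ j) r
    later (inj₁ l) _ ()
    later (inj₂ l) lt i≢l = i≢l (sym (onlyMateAfter l lt))
    earlier : ∀ r → pos r < pos (inj₁ i) → CRE n (inj₂ j) r → CRE n (inj₁ i) r
    earlier (inj₁ l) lt j≢l = j≢l (sym (onlyMateBefore l lt))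
    earlier (inj₂ l) _ ()

  consistentPair₂₁ : ∀ {i j} → i ≢ j →
    (∀ l → pos (inj₁ j) < pos (inj₁ l) → l ≡ i) → (∀ l → pos (inj₂ l) < pos (inj₂ i) → l ≡ j) →
    ConsistentPair (CR n) pos (inj₂ i) (inj₁ j)
  consistentPair₂₁ {i} {j} i≢j onlyMateAfter onlyMateBefore = i≢j , later , earlier
    where
    later : ∀ r → pos (inj₁ j) < pos r → CRE n (inj₂ i) r → CRE n (inj₁ j) r
    later (inj₁ l) lt i≢l = i≢l (sym (onlyMateAfter l lt))
    later (inj₂ l) _ ()
    earlier : ∀ r → pos r < pos (inj₂ i) → CRE n (inj₁ j) r → CRE n (inj₂ i) r
    earlier (inj₁ l) _ ()
    earlier (inj₂ l) lt j≢l = j≢l (sym (onlyMateBefore l lt))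

leftInverse⇒injective : ∀ {A B : Set} (f : A → B) (g : B → A) → (∀ x → g (f x) ≡ x) →
  Injective _≡_ _≡_ f
leftInverse⇒injective f g g∘f≗id = inverseʳ⇒injective f (strictlyInverseʳ⇒inverseʳ {f⁻¹ = g} f g∘f≗id)

splitAt-injective : ∀ m {n} → Injective _≡_ _≡_ (splitAt m {n})
splitAt-injective m {n} = leftInverse⇒injective (splitAt m) (join m n) (Finₚ.join-splitAt m n)

join-injective : ∀ m n → Injective _≡_ _≡_ (join m n)
join-injective m n = leftInverse⇒injective (join m n) (splitAt m) (Finₚ.splitAt-join m n)

module CrownLowerBound {n k} (pos : Vertex (2 + n) → ℕ) (c : Vertex (2 + n) → Fin k)
  (pos-inj : Injective _≡_ _≡_ pos) (clique : CliquePartition (CR (2 + n)) c)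
  (consistent : Consistent (CR (2 + n)) pos c) where

  module A = TopTwo (pos ∘ inj₁)
  module B = TopTwo (pos ∘ inj₂)

  early : Fin n ⊎ Fin n → Vertex (2 + n)
  early (inj₁ j) = inj₁ (A.others j)
  early (inj₂ j) = inj₂ (B.others j)

  early-injective : Injective _≡_ _≡_ early
  early-injective {inj₁ _} {inj₁ _} eq = cong inj₁ (A.others-injective (inj₁-injective eq))
  early-injective {inj₂ _} {inj₂ _} eq = cong inj₂ (B.others-injective (inj₂-injective eq))

  early-firstInClass : ∀ p s → c p ≡ c (early s) → ¬ pos p < pos (early s)
  early-firstInClass (inj₁ i) (inj₁ j) eq lt = clique _ _ eq λ e → <-irrefl (cong pos e) lt
  early-firstInClass (inj₂ i) (inj₂ j) eq lt = clique _ _ eq λ e → <-irrefl (cong pos e) lt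
  early-firstInClass (inj₁ i) (inj₂ j) eq lt with B.others-dominated i j
  ... | l , l≢i , l≢q , q≤l = consistent _ _ (inj₂ l) lt
          (≤∧≢⇒< q≤l (l≢q ∘ sym ∘ inj₂-injective ∘ pos-inj)) eq (l≢i ∘ sym)
  early-firstInClass (inj₂ i) (inj₁ j) eq lt with A.others-dominated i j
  ... | l , l≢i , l≢q , q≤l = consistent _ _ (inj₁ l) lt
          (≤∧≢⇒< q≤l (l≢q ∘ sym ∘ inj₁-injective ∘ pos-inj)) eq (l≢i ∘ sym)

  c∘early-injective : Injective _≡_ _≡_ (c ∘ early)
  c∘early-injective {s} {s′} eq with <-cmp (pos (early s)) (pos (early s′))
  ... | tri< lt _ _ = ⊥-elim (early-firstInClass _ s′ eq lt)
  ... | tri≈ _ e _ = early-injective (pos-inj e)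
  ... | tri> _ _ gt = ⊥-elim (early-firstInClass _ s (sym eq) gt)

  n+n≤k : n + n ≤ k
  n+n≤k = Finₚ.injective⇒≤ {f = c ∘ early ∘ splitAt n} (splitAt-injective n ∘ c∘early-injective)

2*[2+n]∸4≡n+n : ∀ n → 2 * (2 + n) ∸ 4 ≡ n + n
2*[2+n]∸4≡n+n n = begin
  2 * (2 + n) ∸ 4  ≡⟨ cong (_∸ 4) (*-distribˡ-+ 2 2 n) ⟩
  2 * n            ≡⟨ cong (n +_) (+-identityʳ n) ⟩
  n + n            ∎
  where open ≡-Reasoning

crown-lowerBound : ∀ n k → HasCompleteThin (CR (2 + n)) k → 2 * (2 + n) ∸ 4 ≤ k
crown-lowerBound n k (pos , c , pos-inj , _ , clique , consistent) =
  subst (_≤ k) (sym (2*[2+n]∸4≡n+n n)) (CrownLowerBound.n+n≤k pos c pos-inj clique consistent)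

side-lowerBound : ∀ n k → HasCompleteThin (CR n) k → n ≤ k
side-lowerBound n k = independent⇒≤ inj₁ inj₁-injective λ _ _ ()

CR₁-lowerBound : ∀ k → HasCompleteThin (CR 1) k → 2 ≤ k
CR₁-lowerBound k = independent⇒≤ (splitAt 1) (splitAt-injective 1) edgeless
  where
  edgeless : ∀ i j → ¬ CRE 1 (splitAt 1 i) (splitAt 1 j)
  edgeless zero (suc zero) 0≢0 = 0≢0 refl
  edgeless (suc zero) zero 0≢0 = 0≢0 refl

module _ {n : ℕ} where

  _≟ᵛ_ : (p q : Vertex n) → Dec (p ≡ q)
  _≟ᵛ_ = ≡-dec _≟ᶠ_ _≟ᶠ_

  allVertices? : {P : Vertex n → Set} → (∀ v → Dec (P v)) → Dec (∀ v → P v)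
  allVertices? P? = map′ (λ { (all₁ , all₂) → λ { (inj₁ i) → all₁ i ; (inj₂ i) → all₂ i } })
    (λ all → all ∘ inj₁ , all ∘ inj₂) (Finₚ.all? (P? ∘ inj₁) ×-dec Finₚ.all? (P? ∘ inj₂))

  anyVertex? : {P : Vertex n → Set} → (∀ v → Dec (P v)) → Dec (∃[ v ] P v)
  anyVertex? P? = map′ (λ { (inj₁ (i , p)) → inj₁ i , p ; (inj₂ (i , p)) → inj₂ i , p })
    (λ { (inj₁ i , p) → inj₁ (i , p) ; (inj₂ i , p) → inj₂ (i , p) })
    (Finₚ.any? (P? ∘ inj₁) ⊎-dec Finₚ.any? (P? ∘ inj₂))

  CRE? : (p q : Vertex n) → Dec (CRE n p q)
  CRE? (inj₁ _) (inj₁ _) = no λ ()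
  CRE? (inj₁ i) (inj₂ j) = ¬? (i ≟ᶠ j)
  CRE? (inj₂ i) (inj₁ j) = ¬? (i ≟ᶠ j)
  CRE? (inj₂ _) (inj₂ _) = no λ ()

  injective? : (pos : Vertex n → ℕ) → Dec (Injective _≡_ _≡_ pos)
  injective? pos = map′ (λ inj {p} {q} → inj p q) (λ inj p q → inj)
    (allVertices? λ p → allVertices? λ q → (pos p ≟ pos q) →-dec (p ≟ᵛ q))

  surjective? : ∀ {k} (c : Vertex n → Fin k) → Dec (Surjective _≡_ _≡_ c)
  surjective? c = map′ strictlySurjective⇒surjective (λ surj y → proj₁ (surj y) , proj₂ (surj y) refl)
    (Finₚ.all? λ y → anyVertex? λ v → c v ≟ᶠ y)

  cliquePartition? : ∀ {k} (c : Vertex n → Fin k) → Dec (CliquePartition (CR n) c)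
  cliquePartition? c =
    allVertices? λ p → allVertices? λ q → (c p ≟ᶠ c q) →-dec (¬? (p ≟ᵛ q) →-dec CRE? p q)

  consistent? : ∀ {k} (pos : Vertex n → ℕ) (c : Vertex n → Fin k) → Dec (Consistent (CR n) pos c)
  consistent? pos c = allVertices? λ p → allVertices? λ q → allVertices? λ r →
    (pos p <? pos q) →-dec ((pos q <? pos r) →-dec ((c p ≟ᶠ c q) →-dec (CRE? p r →-dec CRE? q r)))

  consistentRev? : ∀ {k} (pos : Vertex n → ℕ) (c : Vertex n → Fin k) → Dec (ConsistentRev (CR n) pos c)
  consistentRev? pos c = allVertices? λ p → allVertices? λ q → allVertices? λ r →
    (pos r <? pos q) →-dec ((pos q <? pos p) →-dec ((c p ≟ᶠ c q) →-dec (CRE? p r →-dec CRE? q r)))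

  properThin? : ∀ {k} (pos : Vertex n → ℕ) (c : Vertex n → Fin k) →
    Dec (Injective _≡_ _≡_ pos × Surjective _≡_ _≡_ c × CliquePartition (CR n) c ×
         Consistent (CR n) pos c × ConsistentRev (CR n) pos c)
  properThin? pos c =
    injective? pos ×-dec surjective? c ×-dec cliquePartition? c ×-dec consistent? pos c ×-dec consistentRev? pos c

pattern i₀ = zero
pattern i₁ = suc zero
pattern i₂ = suc (suc zero)
pattern i₃ = suc (suc (suc zero))
pattern mid t = suc (suc (suc (suc t)))

CR₁-properThin : HasCompleteProperThin (CR 1) 2
CR₁-properThin = pos , c , from-yes (properThin? pos c)
  where
  pos : Vertex 1 → ℕ
  pos (inj₁ _) = 0
  pos (inj₂ _) = 1
  c : Vertex 1 → Fin 2
  c (inj₁ _) = i₀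
  c (inj₂ _) = i₁

CR₂-properThin : HasCompleteProperThin (CR 2) 2
CR₂-properThin = pos , c , from-yes (properThin? pos c)
  where
  pos : Vertex 2 → ℕ
  pos (inj₁ i₀) = 0
  pos (inj₁ i₁) = 1
  pos (inj₂ i₀) = 2
  pos (inj₂ i₁) = 3
  c : Vertex 2 → Fin 2
  c (inj₁ i) = i
  c (inj₂ i₀) = i₁
  c (inj₂ i₁) = i₀

CR₃-properThin : HasCompleteProperThin (CR 3) 3
CR₃-properThin = pos , c , from-yes (properThin? pos c)
  where
  pos : Vertex 3 → ℕ
  pos (inj₁ i₁) = 0
  pos (inj₁ i₀) = 1
  pos (inj₂ i₀) = 2
  pos (inj₁ i₂) = 3
  pos (inj₂ i₂) = 4
  pos (inj₂ i₁) = 5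
  c : Vertex 3 → Fin 3
  c (inj₁ i) = i
  c (inj₂ i₀) = i₂
  c (inj₂ i₁) = i₀
  c (inj₂ i₂) = i₁

_⊕_ : ∀ {B : Set} (a : ℕ) → (B → ℕ) → Fin a ⊎ B → ℕ
(a ⊕ g) (inj₁ i) = toℕ i
(a ⊕ g) (inj₂ y) = a + g y

⊕-injective : ∀ {B : Set} a {g : B → ℕ} → Injective _≡_ _≡_ g → Injective _≡_ _≡_ (a ⊕ g)
⊕-injective a g-inj {inj₁ i} {inj₁ j} eq = cong inj₁ (Finₚ.toℕ-injective eq)
⊕-injective a g-inj {inj₁ i} {inj₂ y} eq = ⊥-elim (<⇒≢ (<-≤-trans (Finₚ.toℕ<n i) (m≤m+n a _)) eq)
⊕-injective a g-inj {inj₂ x} {inj₁ j} eq = ⊥-elim (<⇒≢ (<-≤-trans (Finₚ.toℕ<n j) (m≤m+n a _)) (sym eq))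
⊕-injective a g-inj {inj₂ x} {inj₂ y} eq = cong inj₂ (g-inj (+-cancelˡ-≡ a _ _ eq))

module CrownPartition (m : ℕ) where

  N : ℕ
  N = 4 + m

  Slot : Set
  Slot = Fin 4 ⊎ (Fin m ⊎ (Fin m ⊎ Fin 4))

  slot : Vertex N → Slot
  slot (inj₁ i₀) = inj₁ i₀
  slot (inj₁ i₁) = inj₁ i₁
  slot (inj₂ i₂) = inj₁ i₂
  slot (inj₂ i₃) = inj₁ i₃
  slot (inj₁ (mid t)) = inj₂ (inj₁ t)
  slot (inj₂ (mid t)) = inj₂ (inj₂ (inj₁ t))
  slot (inj₁ i₂) = inj₂ (inj₂ (inj₂ i₀))
  slot (inj₁ i₃) = inj₂ (inj₂ (inj₂ i₁))
  slot (inj₂ i₀) = inj₂ (inj₂ (inj₂ i₂))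
  slot (inj₂ i₁) = inj₂ (inj₂ (inj₂ i₃))

  vertexAt : Slot → Vertex N
  vertexAt (inj₁ i₀) = inj₁ i₀
  vertexAt (inj₁ i₁) = inj₁ i₁
  vertexAt (inj₁ i₂) = inj₂ i₂
  vertexAt (inj₁ i₃) = inj₂ i₃
  vertexAt (inj₂ (inj₁ t)) = inj₁ (mid t)
  vertexAt (inj₂ (inj₂ (inj₁ t))) = inj₂ (mid t)
  vertexAt (inj₂ (inj₂ (inj₂ i₀))) = inj₁ i₂
  vertexAt (inj₂ (inj₂ (inj₂ i₁))) = inj₁ i₃
  vertexAt (inj₂ (inj₂ (inj₂ i₂))) = inj₂ i₀
  vertexAt (inj₂ (inj₂ (inj₂ i₃))) = inj₂ i₁

  vertexAt-slot : ∀ v → vertexAt (slot v) ≡ v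
  vertexAt-slot (inj₁ i₀) = refl
  vertexAt-slot (inj₁ i₁) = refl
  vertexAt-slot (inj₁ i₂) = refl
  vertexAt-slot (inj₁ i₃) = refl
  vertexAt-slot (inj₁ (mid t)) = refl
  vertexAt-slot (inj₂ i₀) = refl
  vertexAt-slot (inj₂ i₁) = refl
  vertexAt-slot (inj₂ i₂) = refl
  vertexAt-slot (inj₂ i₃) = refl
  vertexAt-slot (inj₂ (mid t)) = refl

  pos : Vertex N → ℕ
  pos = (4 ⊕ (m ⊕ (m ⊕ toℕ))) ∘ slot

  pos-injective : Injective _≡_ _≡_ pos
  pos-injective =
    leftInverse⇒injective slot vertexAt vertexAt-slot ∘
    ⊕-injective 4 (⊕-injective m (⊕-injective m Finₚ.toℕ-injective))

  late : ℕ → ℕ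
  late k = 4 + (m + (m + k))

  midA<late : ∀ t k → pos (inj₁ (mid t)) < late k
  midA<late t k = +-monoʳ-< 4 (<-≤-trans (Finₚ.toℕ<n t) (m≤m+n m (m + k)))

  midB<late : ∀ t k → pos (inj₂ (mid t)) < late k
  midB<late t k = +-monoʳ-< 4 (+-monoʳ-< m (<-≤-trans (Finₚ.toℕ<n t) (m≤m+n m k)))

  late<late : ∀ {k k′} → k < k′ → late k < late k′
  late<late = +-monoʳ-< 4 ∘ +-monoʳ-< m ∘ +-monoʳ-< m

  onlyA0BeforeA1 : ∀ l → pos (inj₁ l) < pos (inj₁ i₁) → l ≡ i₀
  onlyA0BeforeA1 i₀ _ = refl
  onlyA0BeforeA1 i₁ (s≤s ())
  onlyA0BeforeA1 i₂ (s≤s ())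
  onlyA0BeforeA1 i₃ (s≤s ())
  onlyA0BeforeA1 (mid t) (s≤s ())

  onlyA3AfterA2 : ∀ l → pos (inj₁ i₂) < pos (inj₁ l) → l ≡ i₃
  onlyA3AfterA2 i₀ ()
  onlyA3AfterA2 i₁ (s≤s ())
  onlyA3AfterA2 i₂ lt = ⊥-elim (<-irrefl refl lt)
  onlyA3AfterA2 i₃ _ = refl
  onlyA3AfterA2 (mid t) lt = ⊥-elim (<-asym lt (midA<late t 0))

  nothingAfterA3 : ∀ l → ¬ pos (inj₁ i₃) < pos (inj₁ l)
  nothingAfterA3 i₀ ()
  nothingAfterA3 i₁ (s≤s ())
  nothingAfterA3 i₂ lt = <-asym lt (late<late ≤-refl)
  nothingAfterA3 i₃ lt = <-irrefl refl lt
  nothingAfterA3 (mid t) lt = <-asym lt (midA<late t 1)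

  nothingBeforeB2 : ∀ l → ¬ pos (inj₂ l) < pos (inj₂ i₂)
  nothingBeforeB2 i₀ (s≤s (s≤s ()))
  nothingBeforeB2 i₁ (s≤s (s≤s ()))
  nothingBeforeB2 i₂ lt = <-irrefl refl lt
  nothingBeforeB2 i₃ (s≤s (s≤s ()))
  nothingBeforeB2 (mid t) (s≤s (s≤s ()))

  onlyB2BeforeB3 : ∀ l → pos (inj₂ l) < pos (inj₂ i₃) → l ≡ i₂
  onlyB2BeforeB3 i₀ (s≤s (s≤s (s≤s ())))
  onlyB2BeforeB3 i₁ (s≤s (s≤s (s≤s ())))
  onlyB2BeforeB3 i₂ _ = refl
  onlyB2BeforeB3 i₃ lt = ⊥-elim (<-irrefl refl lt)
  onlyB2BeforeB3 (mid t) (s≤s (s≤s (s≤s ())))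

  onlyB1AfterB0 : ∀ l → pos (inj₂ i₀) < pos (inj₂ l) → l ≡ i₁
  onlyB1AfterB0 i₀ lt = ⊥-elim (<-irrefl refl lt)
  onlyB1AfterB0 i₁ _ = refl
  onlyB1AfterB0 i₂ (s≤s (s≤s ()))
  onlyB1AfterB0 i₃ (s≤s (s≤s (s≤s ())))
  onlyB1AfterB0 (mid t) lt = ⊥-elim (<-asym lt (midB<late t 2))

  nothingAfterB1 : ∀ l → ¬ pos (inj₂ i₁) < pos (inj₂ l)
  nothingAfterB1 i₀ lt = <-asym lt (late<late ≤-refl)
  nothingAfterB1 i₁ lt = <-irrefl refl lt
  nothingAfterB1 i₂ (s≤s (s≤s ()))
  nothingAfterB1 i₃ (s≤s (s≤s (s≤s ())))
  nothingAfterB1 (mid t) lt = <-asym lt (midB<late t 3)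

  classOf : Vertex N → Fin N ⊎ Fin m
  classOf (inj₁ i) = inj₁ i
  classOf (inj₂ i₀) = inj₁ i₁
  classOf (inj₂ i₁) = inj₁ i₀
  classOf (inj₂ i₂) = inj₁ i₃
  classOf (inj₂ i₃) = inj₁ i₂
  classOf (inj₂ (mid t)) = inj₂ t

  -- Junk value on the classes {a_i}, i ≥ 4, which contain no b-vertex.
  bVertexOf : Fin N ⊎ Fin m → Fin N
  bVertexOf (inj₁ i₀) = i₁
  bVertexOf (inj₁ i₁) = i₀
  bVertexOf (inj₁ i₂) = i₃
  bVertexOf (inj₁ i₃) = i₂
  bVertexOf (inj₁ (mid t)) = mid t
  bVertexOf (inj₂ t) = mid t

  bVertexOf-classOf : ∀ j → bVertexOf (classOf (inj₂ j)) ≡ j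
  bVertexOf-classOf i₀ = refl
  bVertexOf-classOf i₁ = refl
  bVertexOf-classOf i₂ = refl
  bVertexOf-classOf i₃ = refl
  bVertexOf-classOf (mid t) = refl

  representative : Fin N ⊎ Fin m → Vertex N
  representative (inj₁ i) = inj₁ i
  representative (inj₂ t) = inj₂ (mid t)

  classOf-representative : ∀ x → classOf (representative x) ≡ x
  classOf-representative (inj₁ _) = refl
  classOf-representative (inj₂ _) = refl

  c : Vertex N → Fin (N + m)
  c = join N m ∘ classOf

  c-surjective : Surjective _≡_ _≡_ c
  c-surjective = strictlySurjective⇒surjective λ y → representative (splitAt N y) ,
    trans (cong (join N m) (classOf-representative (splitAt N y))) (Finₚ.join-splitAt N m y)

  consistentPair : ∀ {p q} → classOf p ≡ classOf q → pos p < pos q → ConsistentPair (CR N) pos p q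
  consistentPair {inj₁ _} {inj₁ _} refl lt = ⊥-elim (<-irrefl refl lt)
  consistentPair {inj₂ _} {inj₂ _} eq lt =
    ⊥-elim (<-irrefl (cong (pos ∘ inj₂) (leftInverse⇒injective (classOf ∘ inj₂) bVertexOf bVertexOf-classOf eq)) lt)
  consistentPair {inj₁ _} {inj₂ i₀} refl _ = consistentPair₁₂ pos (λ ()) onlyB1AfterB0 onlyA0BeforeA1
  consistentPair {inj₁ _} {inj₂ i₁} refl _ =
    consistentPair₁₂ pos (λ ()) (λ l → ⊥-elim ∘ nothingAfterB1 l) (λ _ ())
  consistentPair {inj₁ _} {inj₂ i₂} refl (s≤s (s≤s ()))
  consistentPair {inj₁ _} {inj₂ i₃} refl (s≤s (s≤s (s≤s ())))
  consistentPair {inj₁ _} {inj₂ (mid _)} () _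
  consistentPair {inj₂ i₀} {inj₁ _} refl (s≤s ())
  consistentPair {inj₂ i₁} {inj₁ _} refl ()
  consistentPair {inj₂ i₂} {inj₁ _} refl _ =
    consistentPair₂₁ pos (λ ()) (λ l → ⊥-elim ∘ nothingAfterA3 l) (λ l → ⊥-elim ∘ nothingBeforeB2 l)
  consistentPair {inj₂ i₃} {inj₁ _} refl _ = consistentPair₂₁ pos (λ ()) onlyA3AfterA2 onlyB2BeforeB3
  consistentPair {inj₂ (mid _)} {inj₁ _} () _

  properThin : HasCompleteProperThin (CR N) (N + m)
  properThin = consistentPairs⇒properThin pos c CRE-sym pos-injective c-surjective
    (consistentPair ∘ join-injective N m)

2*[4+m]∸4≡4+m+m : ∀ m → 2 * (4 + m) ∸ 4 ≡ 4 + m + m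
2*[4+m]∸4≡4+m+m m = begin
  2 * (4 + m) ∸ 4  ≡⟨ cong (_∸ 4) (*-distribˡ-+ 2 4 m) ⟩
  4 + 2 * m        ≡⟨ cong (λ z → 4 + (m + z)) (+-identityʳ m) ⟩
  4 + m + m        ∎
  where open ≡-Reasoning

crown-thinness : ∀ n → 4 ≤ n → ThinCmpIs (CR n) (2 * n ∸ 4) × PThinCmpIs (CR n) (2 * n ∸ 4)
crown-thinness (suc (suc (suc (suc m)))) (s≤s (s≤s (s≤s (s≤s z≤n)))) = thinCmpIs×pthinCmpIs
  (subst (HasCompleteProperThin (CR (4 + m))) (sym (2*[4+m]∸4≡4+m+m m)) (CrownPartition.properThin m))
  (crown-lowerBound (2 + m))

theorem18 : ((n : ℕ) → 4 ≤ n → ThinCmpIs (CR n) (2 * n ∸ 4) × PThinCmpIs (CR n) (2 * n ∸ 4))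
    × (ThinCmpIs (CR 3) 3 × PThinCmpIs (CR 3) 3)
    × (ThinCmpIs (CR 1) 2 × PThinCmpIs (CR 1) 2)
    × (ThinCmpIs (CR 2) 2 × PThinCmpIs (CR 2) 2)
theorem18 =
  crown-thinness ,
  thinCmpIs×pthinCmpIs CR₃-properThin (side-lowerBound 3) ,
  thinCmpIs×pthinCmpIs CR₁-properThin CR₁-lowerBound ,
  thinCmpIs×pthinCmpIs CR₂-properThin (side-lowerBound 2)
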